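{- Let $f(x)=a_1x^q+a_4x^{q^4}$ and $g(x)=b_1x^q+b_4x^{q^4}$ be $q$-polynomials over $\mathbb{F}_{q^6}$ (with $a_1,a_4,b_1,b_4\in\mathbb{F}_{q^6}$). If $L_f=L_g$, then \[a_4^{q^4+q^2+1}=b_4^{q^4+q^2+1}.\]
   Context: For a $q$-polynomial $h$ over $\mathbb{F}_{q^n}$, $L_h=\{\langle (x,h(x))\rangle_{\mathbb{F}_{q^n}} : x\in\mathbb{F}_{q^n}^*\}$, a set of points of the projective line $\mathrm{PG}(1,q^n)$. -}

module Defs where

open import Level using (0ℓ)
open import Data.Nat using (ℕ; zero; suc)
open import Data.Fin using (Fin)
open import Data.Product using (Σ; ∃; _×_; _,_)
open import Relation.Binary.PropositionalEquality using (_≡_)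
open import Relation.Nullary using (¬_)
open import Algebra.Structures using (IsCommutativeRing)
open import Function.Bundles using (_↔_; _⇔_)

record Field : Set₁ where
  field
    Carrier : Set
    _+_ _*_ : Carrier → Carrier → Carrier
    -_      : Carrier → Carrier
    0# 1#   : Carrier
    isCommutativeRing : IsCommutativeRing _≡_ _+_ _*_ -_ 0# 1#
    1≢0     : ¬ (1# ≡ 0#)
    inverse : ∀ x → ¬ (x ≡ 0#) → ∃ λ y → x * y ≡ 1#

  infixl 7 _*_
  infixl 6 _+_

  _^_ : Carrier → ℕ → Carrier
  x ^ zero  = 1#
  x ^ suc n = x * (x ^ n)

  infixr 8 _^_

  HasOrder : ℕ → Set
  HasOrder N = Carrier ↔ Fin N

  -- two nonzero vectors of F² span the same point ⟨u⟩ = ⟨v⟩ of PG(1,F)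
  SamePoint : Carrier × Carrier → Carrier × Carrier → Set
  SamePoint (u₁ , u₂) (v₁ , v₂) =
    ∃ λ c → ¬ (c ≡ 0#) × (u₁ ≡ c * v₁) × (u₂ ≡ c * v₂)

  -- u represents a point of L_h = { ⟨(x, h(x))⟩ : x ∈ F* }
  InL : (Carrier → Carrier) → Carrier × Carrier → Set
  InL h u = ∃ λ x → ¬ (x ≡ 0#) × SamePoint u (x , h x)

  SameL : (Carrier → Carrier) → (Carrier → Carrier) → Set
  SameL f g = ∀ u → InL f u ⇔ InL g u

module Submission where

open import Defs
open import Data.Nat using (ℕ; suc) renaming (_^_ to _^ℕ_; _+_ to _+ℕ_)
open import Data.Nat.Primality using (Prime)
open import Relation.Binary.PropositionalEquality using (_≡_)

open import Algebra.Bundles using (CommutativeMonoid; CommutativeRing)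
open import Algebra.Structures using (IsCommutativeMonoid; IsCommutativeRing)
import Algebra.Properties.CommutativeMonoid.Sum as MonoidSum
import Algebra.Properties.CommutativeSemiring.Binomial as Binomial
import Algebra.Properties.Ring as RingProperties
import Algebra.Properties.Semiring.Exp as SemiringExp
import Algebra.Properties.Semiring.Mult as SemiringMult
import Algebra.Properties.Semiring.Sum as SemiringSum
import Algebra.Solver.Ring.NaturalCoefficients as NaturalCoefficients
open import Data.Bool using (if_then_else_)
open import Data.Empty using (⊥-elim)
open import Data.Fin using (Fin; toℕ; fromℕ; inject₁)
import Data.Fin as Fin
import Data.Fin.Properties as Fin
open import Data.Fin.Permutation using (permutation)
open import Data.List using (List; []; _∷_; _++_; map; length; replicate; tabulate; take; drop)
open import Data.List.Properties using (length-tabulate; length-replicate; take++drop≡id)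
open import Data.List.Relation.Unary.All as All using (All; []; _∷_)
import Data.List.Relation.Unary.All.Properties as AllProperties
open import Data.List.Relation.Unary.AllPairs using (_∷_)
open import Data.List.Relation.Unary.Unique.Propositional using (Unique)
open import Data.List.Relation.Unary.Unique.Propositional.Properties using (tabulate⁺)
open import Data.Maybe using (Maybe; just; nothing)
open import Data.Nat as ℕ using (zero; pred; _∸_; _<_; _≤_; z≤n; s≤s; _!)
import Data.Nat.Properties as ℕ
open import Data.Nat.Properties using (_!*_!≢0)
open import Data.Nat.Combinatorics using (_C_; nCn≡1; nCk≡n!/k![n-k]!; k![n∸k]!∣n!)
open import Data.Nat.DivMod using (m/n*n≡m)
open import Data.Nat.Divisibility using (_∣_; divides; ∣⇒≤; m∣m*n; ∣1⇒≡1)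
open import Data.Nat.Primality using (euclidsLemma; prime⇒nonTrivial)
open import Data.Nat.Solver using (module +-*-Solver)
open import Data.Product using (∃; ∃₂; _×_; _,_)
open import Data.Sum using (inj₁; inj₂)
open import Function using (_∘_)
open import Function.Bundles using (_↔_; _⇔_; Inverse; Equivalence; mk⇔)
open import Level using (0ℓ)
open import Relation.Binary.Definitions using (DecidableEquality)
open import Relation.Nullary using (¬_; Dec; yes; no; does; ¬?)
open import Relation.Nullary.Decidable using (_×-dec_; map′)
open import Relation.Binary.PropositionalEquality
  using (_≢_; refl; sym; trans; cong; cong₂; subst; subst₂; module ≡-Reasoning)

-- Write L = q⁶ - 1 and slope h x = h(x)/x. For additive h the point ⟨(1, m)⟩ lies on L_h iff m
-- is the slope of some x ≠ 0, and the number of such x, read in F, is |ker(h - m)| - 1: that is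
-- -1 if m is a slope and 0 otherwise, since a nontrivial additive subgroup has order divisible by
-- the characteristic. So L_f = L_g gives Σₓ ψ(f(x)/x) = Σₓ ψ(g(x)/x) whenever ψ(0) = 0.
-- Take ψ(m) = m^(q⁴+q²+1). As f(x)/x = a₁x^(q-1) + a₄x^(q⁴-1) and raising to the powers q⁴ and q²
-- is additive, the sum for f expands into eight power sums Σₓ x^e weighted by products of a₁, a₄.
-- A power sum is -1 if L divides e > 0 and 0 otherwise, and only the term a₄^(q⁴+q²+1) has L | e.
-- Hence -a₄^(q⁴+q²+1) = -b₄^(q⁴+q²+1).

prime∤factorial : ∀ {p} → Prime p → ∀ m → m < p → ¬ (p ∣ m !)
prime∤factorial p-prime zero    _   p∣1 with ∣1⇒≡1 p∣1
... | refl with () ← prime⇒nonTrivial p-prime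
prime∤factorial p-prime (suc m) m<p p∣m! with euclidsLemma (suc m) (m !) p-prime p∣m!
... | inj₁ p∣1+m = ℕ.<⇒≱ m<p (∣⇒≤ p∣1+m)
... | inj₂ p∣m!  = prime∤factorial p-prime m (ℕ.<-trans (ℕ.n<1+n m) m<p) p∣m!

prime∣binomial : ∀ {p j} → Prime p → 0 < j → j < p → p ∣ p C j
prime∣binomial {p} {j} p-prime 0<j j<p
  with euclidsLemma (p C j) (j ! ℕ.* (p ∸ j) !) p-prime p∣C*denominator
  where
  instance _ = j !* (p ∸ j) !≢0
  p∣C*denominator : p ∣ (p C j) ℕ.* (j ! ℕ.* (p ∸ j) !)
  p∣C*denominator = subst (p ∣_) (sym (begin
    (p C j) ℕ.* (j ! ℕ.* (p ∸ j) !)  ≡⟨ cong (ℕ._* (j ! ℕ.* (p ∸ j) !)) (nCk≡n!/k![n-k]! (ℕ.<⇒≤ j<p)) ⟩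
    _                                ≡⟨ m/n*n≡m (k![n∸k]!∣n! (ℕ.<⇒≤ j<p)) ⟩
    p !                              ∎)) (p∣p! p (ℕ.<-trans 0<j j<p))
    where
    open ≡-Reasoning
    p∣p! : ∀ n → 0 < n → n ∣ n !
    p∣p! (suc n) _ = m∣m*n (n !)
... | inj₁ p∣C = p∣C
... | inj₂ p∣denominator with euclidsLemma (j !) ((p ∸ j) !) p-prime p∣denominator
...   | inj₁ p∣j!   = ⊥-elim (prime∤factorial p-prime j j<p p∣j!)
...   | inj₂ p∣p-j! = ⊥-elim (prime∤factorial p-prime (p ∸ j) (ℕ.∸-monoʳ-< 0<j (ℕ.<⇒≤ j<p)) p∣p-j!)

prime^[1+k]≥2 : ∀ {p} → Prime p → ∀ k → 2 ≤ p ^ℕ suc k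
prime^[1+k]≥2 {p} p-prime k = ℕ.≤-trans (ℕ.nonTrivial⇒n>1 p {{prime⇒nonTrivial p-prime}})
  (ℕ.m≤m*n p (p ^ℕ k) {{ℕ.m^n≢0 p k {{ℕ.nonTrivial⇒nonZero p {{prime⇒nonTrivial p-prime}}}}}})

≥2⇒2+ : ∀ {q} → 2 ≤ q → ∃ λ k → q ≡ 2 +ℕ k
≥2⇒2+ (s≤s (s≤s {n = k} _)) = k , refl

module FiniteSet {A : Set} {N : ℕ} (enum : A ↔ Fin N) where
  open Inverse enum using (to; from; strictlyInverseˡ; strictlyInverseʳ)
  open ≡-Reasoning

  -- opaque, so that `with x ≟ y` abstracts it in goals that mention it
  infix 4 _≟_
  opaque
    _≟_ : DecidableEquality A
    x ≟ y = map′ to-injective (cong to) (to x Fin.≟ to y)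
      where
      to-injective : ∀ {x y} → to x ≡ to y → x ≡ y
      to-injective {x} {y} eq = trans (sym (strictlyInverseʳ x)) (trans (cong from eq) (strictlyInverseʳ y))

  if-cong : ∀ {P Q : Set} {B : Set} (p : Dec P) (q : Dec Q) {u v : B} →
    (P → Q) → (Q → P) → (if does p then u else v) ≡ (if does q then u else v)
  if-cong (yes _) (yes _) _   _   = refl
  if-cong (no _)  (no _)  _   _   = refl
  if-cong (yes p) (no ¬q) P→Q _   = ⊥-elim (¬q (P→Q p))
  if-cong (no ¬p) (yes q) _   Q→P = ⊥-elim (¬p (Q→P q))

  module BigOperator {M : Set} (_∙_ : M → M → M) (ε : M) (isCM : IsCommutativeMonoid _≡_ _∙_ ε) where
    private
      monoid : CommutativeMonoid _ _
      monoid = record { isCommutativeMonoid = isCM }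
    open IsCommutativeMonoid isCM using (assoc; comm; identityˡ)
    open MonoidSum monoid using (sum; sum-cong-≗; ∑-distrib-+; ∑-comm; sum-permute; sum-replicate; sum-replicate-zero)
    open CommutativeMonoid monoid using (rawMonoid)
    open import Algebra.Definitions.RawMonoid rawMonoid public using () renaming (_×_ to _·_)

    ⨁ : (A → M) → M
    ⨁ f = sum (f ∘ from)

    except : A → (A → M) → A → M
    except a f x = if does (x ≟ a) then ε else f x

    ⨁-cong : ∀ {f g} → (∀ x → f x ≡ g x) → ⨁ f ≡ ⨁ g
    ⨁-cong f≗g = sum-cong-≗ (f≗g ∘ from)

    ⨁-distrib : ∀ f g → ⨁ (λ x → f x ∙ g x) ≡ ⨁ f ∙ ⨁ g
    ⨁-distrib f g = ∑-distrib-+ (f ∘ from) (g ∘ from)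

    ⨁-comm : ∀ (f : A → A → M) → ⨁ (λ x → ⨁ (f x)) ≡ ⨁ (λ y → ⨁ (λ x → f x y))
    ⨁-comm f = ∑-comm (λ i j → f (from i) (from j))

    ⨁-identity : ⨁ (λ _ → ε) ≡ ε
    ⨁-identity = sum-replicate-zero N

    ⨁-closed : ∀ (P : M → Set) → P ε → (∀ {a b} → P a → P b → P (a ∙ b)) → ∀ f → (∀ x → P (f x)) → P (⨁ f)
    ⨁-closed P Pε P∙ f Pf = fin (f ∘ from) (Pf ∘ from)
      where
      fin : ∀ {n} (t : Fin n → M) → (∀ i → P (t i)) → P (sum t)
      fin {zero}  t Pt = Pε
      fin {suc n} t Pt = P∙ (Pt Fin.zero) (fin (t ∘ Fin.suc) (Pt ∘ Fin.suc))

    ⨁-const : ∀ c → ⨁ (λ _ → c) ≡ N · c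
    ⨁-const c = sum-replicate N

    ⨁-reindex : ∀ (σ σ⁻¹ : A → A) → (∀ x → σ (σ⁻¹ x) ≡ x) → (∀ x → σ⁻¹ (σ x) ≡ x) →
      ∀ f → ⨁ (f ∘ σ) ≡ ⨁ f
    ⨁-reindex σ σ⁻¹ σσ⁻¹ σ⁻¹σ f = sym (trans (sum-permute (f ∘ from) π)
                                          (sum-cong-≗ (cong f ∘ strictlyInverseʳ ∘ σ ∘ from)))
      where
      lift : (A → A) → Fin N → Fin N
      lift τ = to ∘ τ ∘ from
      lift-inverse : ∀ τ τ′ → (∀ x → τ (τ′ x) ≡ x) → ∀ i → lift τ (lift τ′ i) ≡ i
      lift-inverse τ τ′ ττ′ i =
        trans (cong (to ∘ τ) (strictlyInverseʳ (τ′ (from i)))) (trans (cong to (ττ′ (from i))) (strictlyInverseˡ i))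
      π = permutation (lift σ) (lift σ⁻¹) (lift-inverse σ σ⁻¹ σσ⁻¹) (lift-inverse σ⁻¹ σ σ⁻¹σ)

    ⨁-split : ∀ f a → ⨁ f ≡ f a ∙ ⨁ (except a f)
    ⨁-split f a = trans (finSplit (f ∘ from) (to a))
                        (cong₂ _∙_ (cong f (strictlyInverseʳ a)) (sum-cong-≗ except-from))
      where
      finSplit : ∀ {n} (t : Fin n → M) i → sum t ≡ t i ∙ sum (λ j → if does (j Fin.≟ i) then ε else t j)
      finSplit t Fin.zero    = cong (t Fin.zero ∙_) (sym (identityˡ _))
      finSplit t (Fin.suc i) = begin
        t₀ ∙ sum (t ∘ Fin.suc)   ≡⟨ cong (t₀ ∙_) (finSplit (t ∘ Fin.suc) i) ⟩
        t₀ ∙ (tᵢ ∙ rest)         ≡⟨ sym (assoc _ _ _) ⟩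
        (t₀ ∙ tᵢ) ∙ rest         ≡⟨ cong (_∙ rest) (comm _ _) ⟩
        (tᵢ ∙ t₀) ∙ rest         ≡⟨ assoc _ _ _ ⟩
        tᵢ ∙ (t₀ ∙ rest)         ∎
        where
        t₀ = t Fin.zero
        tᵢ = t (Fin.suc i)
        rest = sum (λ j → if does (j Fin.≟ i) then ε else t (Fin.suc j))
      except-from : ∀ j → (if does (j Fin.≟ to a) then ε else f (from j)) ≡ except a f (from j)
      except-from j = if-cong (j Fin.≟ to a) (from j ≟ a)
        (λ j≡a → trans (cong from j≡a) (strictlyInverseʳ a))
        (λ j≡a → trans (sym (strictlyInverseˡ j)) (cong to j≡a))

module FieldProperties (F : Field) where
  open Field F public
  open IsCommutativeRing isCommutativeRing public
    using ( +-assoc; +-comm; *-assoc; *-comm; distribˡ; distribʳ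
          ; +-identityˡ; +-identityʳ; *-identityˡ; *-identityʳ
          ; -‿inverseˡ; -‿inverseʳ; zeroˡ; zeroʳ
          ; +-isCommutativeMonoid; *-isCommutativeMonoid )

  commutativeRing : CommutativeRing 0ℓ 0ℓ
  commutativeRing = record { isCommutativeRing = isCommutativeRing }

  open CommutativeRing commutativeRing public using (ring; semiring; commutativeSemiring; _-_)
  open RingProperties ring public
    using ( +-cancelʳ; -‿injective; +-inverseʳ-unique; +-identityʳ-unique
          ; x∙y⁻¹≈ε⇒x≈y; x≈y⇒x∙y⁻¹≈ε; x[y-z]≈xy-xz; -‿distribʳ-* )
  open SemiringMult semiring public using (×1-homo-*) renaming (_×_ to _·_)

  private
    decideℕ : ∀ m n → Maybe (m · 1# ≡ n · 1#)
    decideℕ m n with m ℕ.≟ n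
    ... | yes refl = just refl
    ... | no _     = nothing

  open NaturalCoefficients commutativeSemiring decideℕ public
    using (solve; _:=_; _:+_; _:*_; con)

  open ≡-Reasoning

  x*y≡0⇒y≡0 : ∀ {x y} → x ≢ 0# → x * y ≡ 0# → y ≡ 0#
  x*y≡0⇒y≡0 {x} {y} x≢0 xy≡0 with inverse x x≢0
  ... | x⁻¹ , xx⁻¹≡1 = begin
    y              ≡⟨ sym (*-identityˡ y) ⟩
    1# * y         ≡⟨ cong (_* y) (sym xx⁻¹≡1) ⟩
    (x * x⁻¹) * y  ≡⟨ solve 3 (λ a b c → (a :* b) :* c := b :* (a :* c)) refl x x⁻¹ y ⟩
    x⁻¹ * (x * y)  ≡⟨ cong (x⁻¹ *_) xy≡0 ⟩
    x⁻¹ * 0#       ≡⟨ zeroʳ x⁻¹ ⟩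
    0#             ∎

  *-≢0 : ∀ {x y} → x ≢ 0# → y ≢ 0# → x * y ≢ 0#
  *-≢0 x≢0 y≢0 xy≡0 = y≢0 (x*y≡0⇒y≡0 x≢0 xy≡0)

  private
    [a-b]*c≡0 : ∀ {a b c} → a * c ≡ b * c → (a - b) * c ≡ 0#
    [a-b]*c≡0 {a} {b} {c} ac≡bc = begin
      (a - b) * c    ≡⟨ *-comm _ c ⟩
      c * (a - b)    ≡⟨ x[y-z]≈xy-xz c a b ⟩
      c * a - c * b  ≡⟨ cong₂ _-_ (*-comm c a) (*-comm c b) ⟩
      a * c - b * c  ≡⟨ cong (_- b * c) ac≡bc ⟩
      b * c - b * c  ≡⟨ -‿inverseʳ (b * c) ⟩
      0#             ∎

  *-cancelʳ-≢0 : ∀ {a b c} → c ≢ 0# → a * c ≡ b * c → a ≡ b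
  *-cancelʳ-≢0 {a} {b} {c} c≢0 ac≡bc =
    x∙y⁻¹≈ε⇒x≈y a b (x*y≡0⇒y≡0 c≢0 (trans (*-comm c _) ([a-b]*c≡0 ac≡bc)))

  *≡*⇒≡0 : ∀ {a b c} → a ≢ b → a * c ≡ b * c → c ≡ 0#
  *≡*⇒≡0 {a} {b} a≢b ac≡bc = x*y≡0⇒y≡0 (a≢b ∘ x∙y⁻¹≈ε⇒x≈y a b) ([a-b]*c≡0 ac≡bc)

  ^-homo-+ : ∀ x m n → x ^ (m +ℕ n) ≡ x ^ m * x ^ n
  ^-homo-+ x zero    n = sym (*-identityˡ _)
  ^-homo-+ x (suc m) n = trans (cong (x *_) (^-homo-+ x m n)) (sym (*-assoc _ _ _))

  ^-assocʳ : ∀ x m n → (x ^ m) ^ n ≡ x ^ (m ℕ.* n)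
  ^-assocʳ x m zero    = cong (x ^_) (sym (ℕ.*-zeroʳ m))
  ^-assocʳ x m (suc n) = begin
    x ^ m * (x ^ m) ^ n   ≡⟨ cong (x ^ m *_) (^-assocʳ x m n) ⟩
    x ^ m * x ^ (m ℕ.* n) ≡⟨ sym (^-homo-+ x m (m ℕ.* n)) ⟩
    x ^ (m +ℕ m ℕ.* n)    ≡⟨ cong (x ^_) (sym (ℕ.*-suc m n)) ⟩
    x ^ (m ℕ.* suc n)     ∎

  ^-distrib-* : ∀ x y n → (x * y) ^ n ≡ x ^ n * y ^ n
  ^-distrib-* x y zero    = sym (*-identityˡ 1#)
  ^-distrib-* x y (suc n) = begin
    (x * y) * (x * y) ^ n        ≡⟨ cong ((x * y) *_) (^-distrib-* x y n) ⟩
    (x * y) * (x ^ n * y ^ n)    ≡⟨ solve 4 (λ a b c d → (a :* b) :* (c :* d) := (a :* c) :* (b :* d)) refl x y (x ^ n) (y ^ n) ⟩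
    (x * x ^ n) * (y * y ^ n)    ∎

  1^n≡1 : ∀ n → 1# ^ n ≡ 1#
  1^n≡1 zero    = refl
  1^n≡1 (suc n) = trans (*-identityˡ _) (1^n≡1 n)

  0^[1+n]≡0 : ∀ n → 0# ^ suc n ≡ 0#
  0^[1+n]≡0 n = zeroˡ _

  ^-≢0 : ∀ {x} n → x ≢ 0# → x ^ n ≢ 0#
  ^-≢0 zero    x≢0 = 1≢0
  ^-≢0 (suc n) x≢0 = *-≢0 x≢0 (^-≢0 n x≢0)

  ×1-homo-^ : ∀ m n → (m ^ℕ n) · 1# ≡ (m · 1#) ^ n
  ×1-homo-^ m zero    = +-identityʳ 1#
  ×1-homo-^ m (suc n) = trans (×1-homo-* m (m ^ℕ n)) (cong ((m · 1#) *_) (×1-homo-^ m n))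

  𝟙 : ∀ {A : Set} → Dec A → Carrier
  𝟙 (yes _) = 1#
  𝟙 (no _)  = 0#

  𝟙-yes : ∀ {A : Set} (a : Dec A) → A → 𝟙 a ≡ 1#
  𝟙-yes (yes _) _ = refl
  𝟙-yes (no ¬a) a = ⊥-elim (¬a a)

  𝟙-no : ∀ {A : Set} (a : Dec A) → ¬ A → 𝟙 a ≡ 0#
  𝟙-no (yes a) ¬a = ⊥-elim (¬a a)
  𝟙-no (no _)  _  = refl

  𝟙-cong : ∀ {A B : Set} (a : Dec A) (b : Dec B) → A ⇔ B → 𝟙 a ≡ 𝟙 b
  𝟙-cong (yes _) (yes _) _   = refl
  𝟙-cong (no _)  (no _)  _   = refl
  𝟙-cong (yes a) (no ¬b) A⇔B = ⊥-elim (¬b (Equivalence.to A⇔B a))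
  𝟙-cong (no ¬a) (yes b) A⇔B = ⊥-elim (¬a (Equivalence.from A⇔B b))

  Additive : ℕ → Set
  Additive n = ∀ x y → (x + y) ^ n ≡ x ^ n + y ^ n

  Additive-* : ∀ {m n} → Additive m → Additive n → Additive (m ℕ.* n)
  Additive-* {m} {n} addₘ addₙ x y = begin
    (x + y) ^ (m ℕ.* n)           ≡⟨ sym (^-assocʳ (x + y) m n) ⟩
    ((x + y) ^ m) ^ n             ≡⟨ cong (_^ n) (addₘ x y) ⟩
    (x ^ m + y ^ m) ^ n           ≡⟨ addₙ (x ^ m) (y ^ m) ⟩
    (x ^ m) ^ n + (y ^ m) ^ n     ≡⟨ cong₂ _+_ (^-assocʳ x m n) (^-assocʳ y m n) ⟩
    x ^ (m ℕ.* n) + y ^ (m ℕ.* n) ∎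

  Additive-^ : ∀ {m} → Additive m → ∀ k → Additive (m ^ℕ k)
  Additive-^     addₘ zero    x y = trans (*-identityʳ _) (sym (cong₂ _+_ (*-identityʳ x) (*-identityʳ y)))
  Additive-^ {m} addₘ (suc k) = Additive-* {m} {m ^ℕ k} addₘ (Additive-^ addₘ k)

  Additive⇒0^n≡0 : ∀ {n} → Additive n → 0# ^ n ≡ 0#
  Additive⇒0^n≡0 {n} addₙ =
    +-identityʳ-unique (0# ^ n) (0# ^ n) (sym (trans (cong (_^ n) (sym (+-identityʳ 0#))) (addₙ 0# 0#)))

  freshmansDream : ∀ m → (∀ {j} → 0 < j → j < suc m → (suc m C j) · 1# ≡ 0#) → Additive (suc m)
  freshmansDream m middle≡0 x y = begin
    (x + y) ^ suc m                                 ≡⟨ ^≡^ᴱ (x + y) (suc m) ⟩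
    (x + y) ^ᴱ suc m                                ≡⟨ theorem (suc m) x y ⟩
    term Fin.zero + sum (λ i → term (Fin.suc i))    ≡⟨ cong (term Fin.zero +_) (sum-init-last (λ i → term (Fin.suc i))) ⟩
    term Fin.zero + (sum (λ i → term (Fin.suc (inject₁ i))) + term (Fin.suc (fromℕ m)))
      ≡⟨ cong₂ (λ a b → term Fin.zero + (a + b)) (trans (sum-cong-≗ middle) (sum-replicate-zero m)) last ⟩
    term Fin.zero + (0# + x ^ suc m)                ≡⟨ cong₂ _+_ first (+-identityˡ _) ⟩
    y ^ suc m + x ^ suc m                           ≡⟨ +-comm _ _ ⟩
    x ^ suc m + y ^ suc m                           ∎
    where
    open SemiringExp semiring using () renaming (_^_ to _^ᴱ_)
    open Binomial commutativeSemiring using (theorem; binomialTerm)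
    open SemiringSum semiring using (sum; sum-init-last; sum-cong-≗; sum-replicate-zero)
    open SemiringMult semiring using (×-assoc-*)

    ^≡^ᴱ : ∀ z n → z ^ n ≡ z ^ᴱ n
    ^≡^ᴱ z zero    = refl
    ^≡^ᴱ z (suc n) = cong (z *_) (^≡^ᴱ z n)

    term : Fin (suc (suc m)) → Carrier
    term = binomialTerm x y (suc m)

    ·-as-* : ∀ n z → n · z ≡ (n · 1#) * z
    ·-as-* n z = sym (trans (×-assoc-* n 1# z) (cong (n ·_) (*-identityˡ z)))

    middle : ∀ i → term (Fin.suc (inject₁ i)) ≡ 0#
    middle i = begin
      (suc m C j) · b         ≡⟨ ·-as-* (suc m C j) b ⟩
      ((suc m C j) · 1#) * b  ≡⟨ cong (_* b) (middle≡0 (s≤s z≤n) (s≤s j-1<m)) ⟩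
      0# * b                  ≡⟨ zeroˡ b ⟩
      0#                      ∎
      where
      j-1<m : toℕ (inject₁ i) < m
      j-1<m = subst (_< m) (sym (Fin.toℕ-inject₁ i)) (Fin.toℕ<n i)
      j = suc (toℕ (inject₁ i))
      b = x ^ᴱ j * y ^ᴱ (suc m ∸ j)

    last : term (Fin.suc (fromℕ m)) ≡ x ^ suc m
    last = begin
      (suc m C suc k) · (x ^ᴱ suc k * y ^ᴱ (m ∸ k))
        ≡⟨ cong (λ k′ → (suc m C suc k′) · (x ^ᴱ suc k′ * y ^ᴱ (m ∸ k′))) (Fin.toℕ-fromℕ m) ⟩
      (suc m C suc m) · (x ^ᴱ suc m * y ^ᴱ (m ∸ m))
        ≡⟨ cong₂ _·_ (nCn≡1 (suc m)) (cong (λ n → x ^ᴱ suc m * y ^ᴱ n) (ℕ.n∸n≡0 m)) ⟩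
      x ^ᴱ suc m * 1# + 0#                          ≡⟨ trans (+-identityʳ _) (*-identityʳ _) ⟩
      x ^ᴱ suc m                                    ≡⟨ sym (^≡^ᴱ x (suc m)) ⟩
      x ^ suc m                                     ∎
      where k = toℕ (fromℕ m)

    first : term Fin.zero ≡ y ^ suc m
    first = trans (+-identityʳ _) (trans (*-identityˡ _) (sym (^≡^ᴱ y (suc m))))

  frobenius : ∀ {p} → Prime p → p · 1# ≡ 0# → Additive p
  frobenius {zero}  p-prime _ with () ← prime⇒nonTrivial p-prime
  frobenius {suc m} p-prime p·1≡0 = freshmansDream m (λ 0<j j<p → multiple·1≡0 (prime∣binomial p-prime 0<j j<p))
    where
    multiple·1≡0 : ∀ {j} → suc m ∣ j → j · 1# ≡ 0#
    multiple·1≡0 (divides t refl) = trans (×1-homo-* t (suc m)) (trans (cong ((t · 1#) *_) p·1≡0) (zeroʳ _))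

  -- monic polynomials: coefficients from the constant term up, the leading 1 left implicit

  evalMonic : List Carrier → Carrier → Carrier
  evalMonic []       x = 1#
  evalMonic (c ∷ cs) x = c + x * evalMonic cs x

  -- the quotient of c ∷ cs by x - r, which does not depend on c
  quotient : Carrier → List Carrier → List Carrier
  quotient r []       = []
  quotient r (c ∷ cs) = evalMonic (c ∷ cs) r ∷ quotient r cs

  length-quotient : ∀ r cs → length (quotient r cs) ≡ length cs
  length-quotient r []       = refl
  length-quotient r (c ∷ cs) = cong suc (length-quotient r cs)

  -- P(x) - P(r) = (x - r) Q(x), with both sides moved so that no subtraction occurs
  divisionIdentity : ∀ r c cs x →
    evalMonic (c ∷ cs) x + r * evalMonic (quotient r cs) x ≡ x * evalMonic (quotient r cs) x + evalMonic (c ∷ cs) r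
  divisionIdentity r c [] x =
    solve 4 (λ c x r o → (c :+ x :* o) :+ r :* o := x :* o :+ (c :+ r :* o)) refl c x r 1#
  divisionIdentity r c (c′ ∷ cs) x = begin
    (c + x * P) + r * (P[r] + x * Q)  ≡⟨ solve 6 (λ c x r P P[r] Q → (c :+ x :* P) :+ r :* (P[r] :+ x :* Q)
                                           := (c :+ r :* P[r]) :+ x :* (P :+ r :* Q)) refl c x r P P[r] Q ⟩
    (c + r * P[r]) + x * (P + r * Q)  ≡⟨ cong (λ z → (c + r * P[r]) + x * z) (divisionIdentity r c′ cs x) ⟩
    (c + r * P[r]) + x * (x * Q + P[r]) ≡⟨ solve 5 (λ c x r P[r] Q → (c :+ r :* P[r]) :+ x :* (x :* Q :+ P[r])
                                           := x :* (P[r] :+ x :* Q) :+ (c :+ r :* P[r])) refl c x r P[r] Q ⟩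
    x * (P[r] + x * Q) + (c + r * P[r]) ∎
    where
    P    = evalMonic (c′ ∷ cs) x
    P[r] = evalMonic (c′ ∷ cs) r
    Q    = evalMonic (quotient r cs) x

  rootsBound : ∀ cs rs → Unique rs → All (λ r → evalMonic cs r ≡ 0#) rs → length rs ≤ length cs
  rootsBound cs       []       _              _                  = z≤n
  rootsBound []       (r ∷ rs) _              (1≡0 ∷ _)          = ⊥-elim (1≢0 1≡0)
  rootsBound (c ∷ cs) (r ∷ rs) (r∉rs ∷ unique) (P[r]≡0 ∷ P[rs]≡0) =
    s≤s (subst (length rs ≤_) (length-quotient r cs)
          (rootsBound (quotient r cs) rs unique (All.zipWith rootOfQuotient (r∉rs , P[rs]≡0))))
    where
    rootOfQuotient : ∀ {s} → r ≢ s × evalMonic (c ∷ cs) s ≡ 0# → evalMonic (quotient r cs) s ≡ 0#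
    rootOfQuotient {s} (r≢s , P[s]≡0) = *≡*⇒≡0 r≢s (begin
      r * Q                         ≡⟨ sym (+-identityˡ _) ⟩
      0# + r * Q                    ≡⟨ cong (_+ r * Q) (sym P[s]≡0) ⟩
      evalMonic (c ∷ cs) s + r * Q  ≡⟨ divisionIdentity r c cs s ⟩
      s * Q + evalMonic (c ∷ cs) r  ≡⟨ cong (s * Q +_) P[r]≡0 ⟩
      s * Q + 0#                    ≡⟨ +-identityʳ _ ⟩
      s * Q                         ∎)
      where Q = evalMonic (quotient r cs) s

  HasSlope : (Carrier → Carrier) → Carrier → Set
  HasSlope h m = ∃ λ x → x ≢ 0# × h x ≡ m * x

  InL⇔HasSlope : ∀ h m → InL h (1# , m) ⇔ HasSlope h m
  InL⇔HasSlope h m = mk⇔ toSlope fromSlope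
    where
    toSlope : InL h (1# , m) → HasSlope h m
    toSlope (x , x≢0 , c , _ , 1≡cx , m≡chx) = x , x≢0 , (begin
      h x            ≡⟨ sym (*-identityʳ _) ⟩
      h x * 1#       ≡⟨ cong (h x *_) 1≡cx ⟩
      h x * (c * x)  ≡⟨ solve 3 (λ a b c → a :* (b :* c) := (b :* a) :* c) refl (h x) c x ⟩
      (c * h x) * x  ≡⟨ cong (_* x) (sym m≡chx) ⟩
      m * x          ∎)

    fromSlope : HasSlope h m → InL h (1# , m)
    fromSlope (x , x≢0 , hx≡mx) with inverse x x≢0
    ... | x⁻¹ , xx⁻¹≡1 = x , x≢0 , x⁻¹ , x⁻¹≢0 , sym (trans (*-comm x⁻¹ x) xx⁻¹≡1) , sym (begin
      x⁻¹ * h x        ≡⟨ cong (x⁻¹ *_) hx≡mx ⟩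
      x⁻¹ * (m * x)    ≡⟨ solve 3 (λ a b c → a :* (b :* c) := b :* (c :* a)) refl x⁻¹ m x ⟩
      m * (x * x⁻¹)    ≡⟨ cong (m *_) xx⁻¹≡1 ⟩
      m * 1#           ≡⟨ *-identityʳ m ⟩
      m                ∎)
      where
      x⁻¹≢0 : x⁻¹ ≢ 0#
      x⁻¹≢0 x⁻¹≡0 = 1≢0 (trans (sym xx⁻¹≡1) (trans (cong (x *_) x⁻¹≡0) (zeroʳ x)))

  SameL⇒sameSlopes : ∀ {f g} → SameL f g → ∀ m → HasSlope f m ⇔ HasSlope g m
  SameL⇒sameSlopes {f} {g} Lf≡Lg m = mk⇔
    (Equivalence.to (InL⇔HasSlope g m) ∘ Equivalence.to (Lf≡Lg (1# , m)) ∘ Equivalence.from (InL⇔HasSlope f m))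
    (Equivalence.to (InL⇔HasSlope f m) ∘ Equivalence.from (Lf≡Lg (1# , m)) ∘ Equivalence.from (InL⇔HasSlope g m))


  Monomial : Set
  Monomial = Carrier × ℕ

  ⟦_⟧ : List Monomial → Carrier → Carrier
  ⟦ []           ⟧ x = 0#
  ⟦ (c , n) ∷ ms ⟧ x = c * x ^ n + ⟦ ms ⟧ x

  infixl 7 _*ᴹ_ _⊗_
  infixr 8 _^ᴹ_

  _*ᴹ_ : Monomial → Monomial → Monomial
  (c , m) *ᴹ (d , n) = c * d , m +ℕ n

  _⊗_ : List Monomial → List Monomial → List Monomial
  []       ⊗ ns = []
  (m ∷ ms) ⊗ ns = map (m *ᴹ_) ns ++ ms ⊗ ns

  _^ᴹ_ : List Monomial → ℕ → List Monomial
  ms ^ᴹ k = map (λ (c , n) → c ^ k , n ℕ.* k) ms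

  ⟦++⟧ : ∀ ms ns x → ⟦ ms ++ ns ⟧ x ≡ ⟦ ms ⟧ x + ⟦ ns ⟧ x
  ⟦++⟧ []             ns x = sym (+-identityˡ _)
  ⟦++⟧ ((c , n) ∷ ms) ns x = trans (cong (c * x ^ n +_) (⟦++⟧ ms ns x)) (sym (+-assoc _ _ _))

  ⟦*ᴹ⟧ : ∀ c m ns x → ⟦ map ((c , m) *ᴹ_) ns ⟧ x ≡ (c * x ^ m) * ⟦ ns ⟧ x
  ⟦*ᴹ⟧ c m []             x = sym (zeroʳ _)
  ⟦*ᴹ⟧ c m ((d , n) ∷ ns) x = begin
    (c * d) * x ^ (m +ℕ n) + ⟦ map ((c , m) *ᴹ_) ns ⟧ x  ≡⟨ cong₂ (λ a b → (c * d) * a + b) (^-homo-+ x m n) (⟦*ᴹ⟧ c m ns x) ⟩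
    (c * d) * (x ^ m * x ^ n) + (c * x ^ m) * ⟦ ns ⟧ x   ≡⟨ solve 5 (λ c d a b r → (c :* d) :* (a :* b) :+ (c :* a) :* r
                                                              := (c :* a) :* (d :* b :+ r)) refl c d (x ^ m) (x ^ n) (⟦ ns ⟧ x) ⟩
    (c * x ^ m) * (d * x ^ n + ⟦ ns ⟧ x)                 ∎

  ⟦⊗⟧ : ∀ ms ns x → ⟦ ms ⊗ ns ⟧ x ≡ ⟦ ms ⟧ x * ⟦ ns ⟧ x
  ⟦⊗⟧ []             ns x = sym (zeroˡ _)
  ⟦⊗⟧ ((c , m) ∷ ms) ns x = begin
    ⟦ map ((c , m) *ᴹ_) ns ++ ms ⊗ ns ⟧ x                 ≡⟨ ⟦++⟧ (map ((c , m) *ᴹ_) ns) (ms ⊗ ns) x ⟩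
    ⟦ map ((c , m) *ᴹ_) ns ⟧ x + ⟦ ms ⊗ ns ⟧ x            ≡⟨ cong₂ _+_ (⟦*ᴹ⟧ c m ns x) (⟦⊗⟧ ms ns x) ⟩
    (c * x ^ m) * ⟦ ns ⟧ x + ⟦ ms ⟧ x * ⟦ ns ⟧ x          ≡⟨ sym (distribʳ _ _ _) ⟩
    (c * x ^ m + ⟦ ms ⟧ x) * ⟦ ns ⟧ x                     ∎

  ⟦^ᴹ⟧ : ∀ {k} → Additive k → ∀ ms x → ⟦ ms ^ᴹ k ⟧ x ≡ ⟦ ms ⟧ x ^ k
  ⟦^ᴹ⟧ {k} addₖ []             x = sym (Additive⇒0^n≡0 {k} addₖ)
  ⟦^ᴹ⟧ {k} addₖ ((c , n) ∷ ms) x = begin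
    c ^ k * x ^ (n ℕ.* k) + ⟦ ms ^ᴹ k ⟧ x  ≡⟨ cong₂ (λ a b → c ^ k * a + b) (sym (^-assocʳ x n k)) (⟦^ᴹ⟧ addₖ ms x) ⟩
    c ^ k * (x ^ n) ^ k + ⟦ ms ⟧ x ^ k     ≡⟨ cong (_+ ⟦ ms ⟧ x ^ k) (sym (^-distrib-* c (x ^ n) k)) ⟩
    (c * x ^ n) ^ k + ⟦ ms ⟧ x ^ k         ≡⟨ sym (addₖ _ _) ⟩
    (c * x ^ n + ⟦ ms ⟧ x) ^ k             ∎

NonzeroResidue : ℕ → ℕ → Set
NonzeroResidue L E = ∃₂ λ e t → 0 < e × e < L × E ≡ e +ℕ L ℕ.* t

module FiniteField (F : Field) (L : ℕ) (enum : Field.Carrier F ↔ Fin (suc L)) where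
  open FieldProperties F
  open FiniteSet enum public using (_≟_)
  open FiniteSet enum using (module BigOperator)
  open Inverse enum using (to; from; strictlyInverseˡ; strictlyInverseʳ)
  open ≡-Reasoning

  private
    module Sum     = BigOperator _+_ 0# +-isCommutativeMonoid
    module Product = BigOperator _*_ 1# *-isCommutativeMonoid

  open Sum public
    using () renaming (⨁ to ∑; ⨁-cong to ∑-cong; ⨁-distrib to ∑-distrib; ⨁-comm to ∑-comm;
                       ⨁-identity to ∑-zero; ⨁-reindex to ∑-reindex; ⨁-split to ∑-split; except to exceptˢ)
  open Product public
    using () renaming (⨁ to ∏; ⨁-cong to ∏-cong; ⨁-distrib to ∏-distrib;
                       ⨁-reindex to ∏-reindex; ⨁-split to ∏-split; except to exceptᵖ)

  ∑-*ˡ : ∀ c f → ∑ (λ x → c * f x) ≡ c * ∑ f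
  ∑-*ˡ c f = sym (SemiringSum.*-distribˡ-sum semiring c (f ∘ from))

  ∑-const : ∀ c → ∑ (λ _ → c) ≡ suc L · c
  ∑-const = Sum.⨁-const

  ∏-const : ∀ c → ∏ (λ _ → c) ≡ c ^ suc L
  ∏-const c = trans (Product.⨁-const c) (iterate≡^ (suc L))
    where
    iterate≡^ : ∀ n → n Product.· c ≡ c ^ n
    iterate≡^ zero    = refl
    iterate≡^ (suc n) = cong (c *_) (iterate≡^ n)

  ∏-≢0 : ∀ f → (∀ x → f x ≢ 0#) → ∏ f ≢ 0#
  ∏-≢0 = Product.⨁-closed (_≢ 0#) 1≢0 *-≢0

  translation : ∀ k f → ∑ (λ x → f (x + k)) ≡ ∑ f
  translation k = ∑-reindex (_+ k) (_- k) (cancel (- k) k (-‿inverseˡ k)) (cancel k (- k) (-‿inverseʳ k))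
    where
    cancel : ∀ a b → a + b ≡ 0# → ∀ x → (x + a) + b ≡ x
    cancel a b a+b≡0 x = trans (+-assoc x a b) (trans (cong (x +_) a+b≡0) (+-identityʳ x))

  characteristic : suc L · 1# ≡ 0#
  characteristic = +-identityʳ-unique (∑ id) (suc L · 1#) (begin
    ∑ id + suc L · 1#          ≡⟨ cong (∑ id +_) (sym (∑-const 1#)) ⟩
    ∑ id + ∑ (λ _ → 1#)        ≡⟨ sym (∑-distrib id (λ _ → 1#)) ⟩
    ∑ (λ x → x + 1#)           ≡⟨ translation 1# id ⟩
    ∑ id                       ∎)
    where id = λ (x : Carrier) → x

  ^≡0⇒≡0 : ∀ {x} n → x ^ n ≡ 0# → x ≡ 0#
  ^≡0⇒≡0 {x} n xⁿ≡0 with x ≟ 0#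
  ... | yes x≡0 = x≡0
  ... | no  x≢0 = ⊥-elim (^-≢0 n x≢0 xⁿ≡0)

  ^≡order⇒·1≡0 : ∀ {m} n → m ^ℕ n ≡ suc L → m · 1# ≡ 0#
  ^≡order⇒·1≡0 {m} n mⁿ≡N = ^≡0⇒≡0 n (begin
    (m · 1#) ^ n    ≡⟨ sym (×1-homo-^ m n) ⟩
    (m ^ℕ n) · 1#   ≡⟨ cong (_· 1#) mⁿ≡N ⟩
    suc L · 1#      ≡⟨ characteristic ⟩
    0#              ∎)

  private
    dilationInverse : ∀ {c} → c ≢ 0# → ∃ λ c⁻¹ → (∀ x → c * (c⁻¹ * x) ≡ x) × (∀ x → c⁻¹ * (c * x) ≡ x)
    dilationInverse {c} c≢0 with inverse c c≢0
    ... | c⁻¹ , cc⁻¹≡1 = c⁻¹ , cancel c c⁻¹ cc⁻¹≡1 , cancel c⁻¹ c (trans (*-comm c⁻¹ c) cc⁻¹≡1)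
      where
      cancel : ∀ a b → a * b ≡ 1# → ∀ x → a * (b * x) ≡ x
      cancel a b ab≡1 x = trans (sym (*-assoc a b x)) (trans (cong (_* x) ab≡1) (*-identityˡ x))

  ∑-dilation : ∀ {c} → c ≢ 0# → ∀ f → ∑ (λ x → f (c * x)) ≡ ∑ f
  ∑-dilation {c} c≢0 with dilationInverse c≢0
  ... | c⁻¹ , cc⁻¹ , c⁻¹c = ∑-reindex (c *_) (c⁻¹ *_) cc⁻¹ c⁻¹c

  ∏-dilation : ∀ {c} → c ≢ 0# → ∀ f → ∏ (λ x → f (c * x)) ≡ ∏ f
  ∏-dilation {c} c≢0 with dilationInverse c≢0
  ... | c⁻¹ , cc⁻¹ , c⁻¹c = ∏-reindex (c *_) (c⁻¹ *_) cc⁻¹ c⁻¹c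

  -- dilation by x ≠ 0 permutes the nonzero elements, and their product is nonzero
  fermat : ∀ x → x ^ suc L ≡ x
  fermat x with x ≟ 0#
  ... | yes refl = 0^[1+n]≡0 L
  ... | no  x≢0  = begin
    x ^ suc L     ≡⟨ sym (∏-const x) ⟩
    ∏ (λ _ → x)   ≡⟨ ∏-split (λ _ → x) 0# ⟩
    x * ∏ xOnNonzero      ≡⟨ cong (x *_) ∏xOnNonzero≡1 ⟩
    x * 1#        ≡⟨ *-identityʳ x ⟩
    x             ∎
    where
    nonzeroPart = exceptᵖ 0# (λ y → y)
    xOnNonzero = exceptᵖ 0# (λ _ → x)

    nonzeroPart≢0 : ∀ y → nonzeroPart y ≢ 0#
    nonzeroPart≢0 y with y ≟ 0#
    ... | yes _   = 1≢0
    ... | no  y≢0 = y≢0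

    nonzeroPart-dilation : ∀ y → nonzeroPart (x * y) ≡ xOnNonzero y * nonzeroPart y
    nonzeroPart-dilation y with y ≟ 0# | x * y ≟ 0#
    ... | yes _   | yes _    = sym (*-identityˡ 1#)
    ... | yes refl | no xy≢0 = ⊥-elim (xy≢0 (zeroʳ x))
    ... | no  y≢0 | yes xy≡0 = ⊥-elim (*-≢0 x≢0 y≢0 xy≡0)
    ... | no  _   | no  _    = refl

    ∏xOnNonzero≡1 : ∏ xOnNonzero ≡ 1#
    ∏xOnNonzero≡1 = *-cancelʳ-≢0 (∏-≢0 nonzeroPart nonzeroPart≢0) (begin
      ∏ xOnNonzero * ∏ nonzeroPart                  ≡⟨ sym (∏-distrib xOnNonzero nonzeroPart) ⟩
      ∏ (λ y → xOnNonzero y * nonzeroPart y)        ≡⟨ sym (∏-cong nonzeroPart-dilation) ⟩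
      ∏ (λ y → nonzeroPart (x * y))         ≡⟨ ∏-dilation x≢0 nonzeroPart ⟩
      ∏ nonzeroPart                         ≡⟨ sym (*-identityˡ _) ⟩
      1# * ∏ nonzeroPart                    ∎)

  x^L≡1 : ∀ {x} → x ≢ 0# → x ^ L ≡ 1#
  x^L≡1 {x} x≢0 = *-cancelʳ-≢0 {c = x} x≢0 (begin
    x ^ L * x   ≡⟨ *-comm _ x ⟩
    x ^ suc L   ≡⟨ fermat x ⟩
    x           ≡⟨ sym (*-identityˡ x) ⟩
    1# * x      ∎)

  L≢0 : L ≢ 0
  L≢0 refl = 1≢0 (begin
    1#              ≡⟨ sym (strictlyInverseʳ 1#) ⟩
    from (to 1#)    ≡⟨ cong from (Fin1-unique (to 1#) (to 0#)) ⟩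
    from (to 0#)    ≡⟨ strictlyInverseʳ 0# ⟩
    0#              ∎)
    where
    Fin1-unique : ∀ (i j : Fin 1) → i ≡ j
    Fin1-unique Fin.zero Fin.zero = refl

  x*x^[L-1]≡1 : ∀ {x} → x ≢ 0# → x * x ^ pred L ≡ 1#
  x*x^[L-1]≡1 {x} x≢0 = trans (cong (x ^_) (ℕ.suc-pred L {{ℕ.≢-nonZero L≢0}})) (x^L≡1 x≢0)

  -- holds at x = 0 because 0 < a
  ^-shift : ∀ x {a} → 0 < a → x ^ suc a * x ^ pred L ≡ x ^ a
  ^-shift x {suc a} _ with x ≟ 0#
  ... | yes refl = trans (cong (_* 0# ^ pred L) (0^[1+n]≡0 (suc a))) (trans (zeroˡ _) (sym (0^[1+n]≡0 a)))
  ... | no  x≢0  = begin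
    (x * x ^ suc a) * x ^ pred L    ≡⟨ solve 3 (λ a b c → (a :* b) :* c := b :* (a :* c)) refl x (x ^ suc a) (x ^ pred L) ⟩
    x ^ suc a * (x * x ^ pred L)    ≡⟨ cong (x ^ suc a *_) (x*x^[L-1]≡1 x≢0) ⟩
    x ^ suc a * 1#                  ≡⟨ *-identityʳ _ ⟩
    x ^ suc a                       ∎

  elements : List Carrier
  elements = tabulate from

  xPolynomial : ℕ → List Carrier
  xPolynomial e = 0# ∷ - 1# ∷ replicate e 0#

  evalMonic-xPolynomial : ∀ e x → evalMonic (xPolynomial e) x ≡ x ^ suc (suc e) - x
  evalMonic-xPolynomial e x = begin
    0# + x * (- 1# + x * evalMonic (replicate e 0#) x)  ≡⟨ cong (λ p → 0# + x * (- 1# + x * p)) (evalMonic-zeros e) ⟩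
    0# + x * (- 1# + x * x ^ e)
      ≡⟨ solve 3 (λ x m p → con 0 :+ x :* (m :+ x :* p) := x :* (x :* p) :+ x :* m) refl x (- 1#) (x ^ e) ⟩
    x ^ suc (suc e) + x * - 1#
      ≡⟨ cong (x ^ suc (suc e) +_) (trans (sym (-‿distribʳ-* x 1#)) (cong -_ (*-identityʳ x))) ⟩
    x ^ suc (suc e) - x                                 ∎
    where
    evalMonic-zeros : ∀ n → evalMonic (replicate n 0#) x ≡ x ^ n
    evalMonic-zeros zero    = refl
    evalMonic-zeros (suc n) = trans (+-identityˡ _) (cong (x *_) (evalMonic-zeros n))

  nontrivialPower : ∀ {e} → 0 < e → e < L → ∃ λ c → c ≢ 0# × c ^ e ≢ 1#
  nontrivialPower {suc e} _ e<L with Fin.all? (λ i → from i ^ suc (suc e) ≟ from i)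
  ... | yes allRoots = ⊥-elim (ℕ.<⇒≱ e<L (ℕ.≤-pred (subst₂ _≤_ (length-tabulate from) (cong (suc ∘ suc) (length-replicate e))
          (rootsBound (xPolynomial e) elements (tabulate⁺ from-injective) (AllProperties.tabulate⁺ isRoot)))))
    where
    from-injective : ∀ {i j} → from i ≡ from j → i ≡ j
    from-injective {i} {j} eq = trans (sym (strictlyInverseˡ i)) (trans (cong to eq) (strictlyInverseˡ j))
    isRoot : ∀ i → evalMonic (xPolynomial e) (from i) ≡ 0#
    isRoot i = trans (evalMonic-xPolynomial e (from i)) (x≈y⇒x∙y⁻¹≈ε (allRoots i))
  ... | no notAllRoots with Fin.¬∀⟶∃¬ (suc L) _ (λ i → from i ^ suc (suc e) ≟ from i) notAllRoots
  ...   | i , c²⁺ᵉ≢c = from i , c≢0 , cᵉ≢1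
    where
    c≢0 : from i ≢ 0#
    c≢0 c≡0 = c²⁺ᵉ≢c (trans (cong (_^ suc (suc e)) c≡0) (trans (0^[1+n]≡0 (suc e)) (sym c≡0)))
    cᵉ≢1 : from i ^ suc e ≢ 1#
    cᵉ≢1 cᵉ≡1 = c²⁺ᵉ≢c (trans (cong (from i *_) cᵉ≡1) (*-identityʳ _))

  powerSum : ℕ → Carrier
  powerSum e = ∑ (λ x → x ^ e)

  powerSum-vanishes : ∀ {e} → 0 < e → e < L → powerSum e ≡ 0#
  powerSum-vanishes {e} 0<e e<L with nontrivialPower 0<e e<L
  ... | c , c≢0 , cᵉ≢1 = *≡*⇒≡0 (cᵉ≢1 ∘ sym) (begin
    1# * powerSum e              ≡⟨ *-identityˡ _ ⟩
    ∑ (λ x → x ^ e)              ≡⟨ sym (∑-dilation c≢0 (_^ e)) ⟩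
    ∑ (λ x → (c * x) ^ e)        ≡⟨ ∑-cong (λ x → ^-distrib-* c x e) ⟩
    ∑ (λ x → c ^ e * x ^ e)      ≡⟨ ∑-*ˡ (c ^ e) (_^ e) ⟩
    c ^ e * powerSum e           ∎)

  powerSum-periodic : ∀ {e} → 0 < e → ∀ t → powerSum (e +ℕ L ℕ.* t) ≡ powerSum e
  powerSum-periodic {suc e} _ t = ∑-cong pointwise
    where
    pointwise : ∀ x → x ^ (suc e +ℕ L ℕ.* t) ≡ x ^ suc e
    pointwise x with x ≟ 0#
    ... | yes refl = trans (0^[1+n]≡0 (e +ℕ L ℕ.* t)) (sym (0^[1+n]≡0 e))
    ... | no  x≢0  = begin
      x ^ (suc e +ℕ L ℕ.* t)       ≡⟨ ^-homo-+ x (suc e) (L ℕ.* t) ⟩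
      x ^ suc e * x ^ (L ℕ.* t)    ≡⟨ cong (x ^ suc e *_) (sym (^-assocʳ x L t)) ⟩
      x ^ suc e * (x ^ L) ^ t      ≡⟨ cong (λ y → x ^ suc e * y ^ t) (x^L≡1 x≢0) ⟩
      x ^ suc e * 1# ^ t           ≡⟨ cong (x ^ suc e *_) (1^n≡1 t) ⟩
      x ^ suc e * 1#               ≡⟨ *-identityʳ _ ⟩
      x ^ suc e                    ∎

  ∑-δ : ∀ a (g : Carrier → Carrier) → ∑ (λ x → 𝟙 (a ≟ x) * g x) ≡ g a
  ∑-δ a g = begin
    ∑ δg                                  ≡⟨ ∑-split δg a ⟩
    δg a + ∑ (exceptˢ a δg)               ≡⟨ cong₂ _+_ at-a (trans (∑-cong elsewhere) ∑-zero) ⟩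
    g a + 0#                              ≡⟨ +-identityʳ _ ⟩
    g a                                   ∎
    where
    δg : Carrier → Carrier
    δg x = 𝟙 (a ≟ x) * g x
    at-a : δg a ≡ g a
    at-a with a ≟ a
    ... | yes _   = *-identityˡ _
    ... | no  a≢a = ⊥-elim (a≢a refl)
    elsewhere : ∀ x → exceptˢ a δg x ≡ 0#
    elsewhere x with x ≟ a | a ≟ x
    ... | yes _   | _        = refl
    ... | no  x≢a | yes a≡x  = ⊥-elim (x≢a (sym a≡x))
    ... | no  _   | no  _    = zeroˡ _

  powerSum-multiple : ∀ {E} → 0 < E → L ∣ E → powerSum E ≡ - 1#
  powerSum-multiple {suc E} _ (divides t sucE≡tL) = +-inverseʳ-unique 1# (powerSum (suc E)) (begin
    1# + powerSum (suc E)                              ≡⟨ cong (_+ powerSum (suc E)) (sym (∑-δ 0# (λ _ → 1#))) ⟩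
    ∑ (λ x → 𝟙 (0# ≟ x) * 1#) + powerSum (suc E)      ≡⟨ sym (∑-distrib (λ x → 𝟙 (0# ≟ x) * 1#) (_^ suc E)) ⟩
    ∑ (λ x → 𝟙 (0# ≟ x) * 1# + x ^ suc E)            ≡⟨ ∑-cong pointwise ⟩
    ∑ (λ _ → 1#)                                       ≡⟨ ∑-const 1# ⟩
    suc L · 1#                                         ≡⟨ characteristic ⟩
    0#                                                 ∎)
    where
    pointwise : ∀ x → 𝟙 (0# ≟ x) * 1# + x ^ suc E ≡ 1#
    pointwise x with 0# ≟ x
    ... | yes refl = trans (cong (1# * 1# +_) (0^[1+n]≡0 E)) (trans (+-identityʳ _) (*-identityˡ 1#))
    ... | no  0≢x  = begin
      0# * 1# + x ^ suc E     ≡⟨ trans (cong (_+ x ^ suc E) (zeroˡ 1#)) (+-identityˡ _) ⟩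
      x ^ suc E               ≡⟨ cong (x ^_) sucE≡tL ⟩
      x ^ (t ℕ.* L)           ≡⟨ cong (x ^_) (ℕ.*-comm t L) ⟩
      x ^ (L ℕ.* t)           ≡⟨ sym (^-assocʳ x L t) ⟩
      (x ^ L) ^ t             ≡⟨ cong (_^ t) (x^L≡1 (0≢x ∘ sym)) ⟩
      1# ^ t                  ≡⟨ 1^n≡1 t ⟩
      1#                      ∎

  ∑-fibres : ∀ (ψ φ : Carrier → Carrier) → ∑ (λ x → ψ (φ x)) ≡ ∑ (λ m → ψ m * ∑ (λ x → 𝟙 (φ x ≟ m)))
  ∑-fibres ψ φ = begin
    ∑ (λ x → ψ (φ x))                                  ≡⟨ sym (∑-cong (λ x → ∑-δ (φ x) ψ)) ⟩
    ∑ (λ x → ∑ (λ m → 𝟙 (φ x ≟ m) * ψ m))              ≡⟨ ∑-comm (λ x m → 𝟙 (φ x ≟ m) * ψ m) ⟩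
    ∑ (λ m → ∑ (λ x → 𝟙 (φ x ≟ m) * ψ m))
      ≡⟨ ∑-cong (λ m → trans (∑-cong (λ x → *-comm (𝟙 (φ x ≟ m)) (ψ m))) (∑-*ˡ (ψ m) (λ x → 𝟙 (φ x ≟ m)))) ⟩
    ∑ (λ m → ψ m * ∑ (λ x → 𝟙 (φ x ≟ m)))              ∎

  -- h(x)/x, extended by 0 at 0
  slope : (Carrier → Carrier) → Carrier → Carrier
  slope h x = h x * x ^ pred L

  hasSlope? : ∀ h m → Dec (HasSlope h m)
  hasSlope? h m = map′ (λ (i , P) → from i , P) (λ (x , x≢0 , hx≡mx) → to x , subst Pᶠ (sym (strictlyInverseʳ x)) (x≢0 , hx≡mx))
    (Fin.any? (λ i → ¬? (from i ≟ 0#) ×-dec (h (from i) ≟ m * from i)))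
    where
    Pᶠ : Carrier → Set
    Pᶠ x = x ≢ 0# × h x ≡ m * x

  module SlopeCount {h : Carrier → Carrier} (h-additive : ∀ x y → h (x + y) ≡ h x + h y) where
    h0≡0 : h 0# ≡ 0#
    h0≡0 = +-identityʳ-unique (h 0#) (h 0#) (sym (trans (cong h (sym (+-identityʳ 0#))) (h-additive 0# 0#)))

    slope≡⇔ : ∀ {x m} → x ≢ 0# → slope h x ≡ m ⇔ h x ≡ m * x
    slope≡⇔ {x} {m} x≢0 = mk⇔
      (λ slope≡m → begin
        h x                       ≡⟨ sym (*-identityʳ _) ⟩
        h x * 1#                  ≡⟨ cong (h x *_) (sym (x*x^[L-1]≡1 x≢0)) ⟩
        h x * (x * x ^ pred L)    ≡⟨ solve 3 (λ a b c → a :* (b :* c) := (a :* c) :* b) refl (h x) x (x ^ pred L) ⟩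
        slope h x * x             ≡⟨ cong (_* x) slope≡m ⟩
        m * x                     ∎)
      (λ hx≡mx → begin
        h x * x ^ pred L          ≡⟨ cong (_* x ^ pred L) hx≡mx ⟩
        (m * x) * x ^ pred L      ≡⟨ *-assoc _ _ _ ⟩
        m * (x * x ^ pred L)      ≡⟨ cong (m *_) (x*x^[L-1]≡1 x≢0) ⟩
        m * 1#                    ≡⟨ *-identityʳ m ⟩
        m                         ∎)

    -- the kernel of h - m is invariant under translation by its element k ≠ 0, so k |ker| = 0
    ∑-kernel≡0 : ∀ {m} → HasSlope h m → ∑ (λ x → 𝟙 (h x ≟ m * x)) ≡ 0#
    ∑-kernel≡0 {m} (k , k≢0 , hk≡mk) = x*y≡0⇒y≡0 k≢0 (+-identityʳ-unique (∑ (λ x → χ x * x)) (k * ∑ χ) (sym (begin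
      ∑ (λ x → χ x * x)                   ≡⟨ sym (translation k (λ x → χ x * x)) ⟩
      ∑ (λ x → χ (x + k) * (x + k))       ≡⟨ ∑-cong (λ x → cong (_* (x + k)) (χ-periodic x)) ⟩
      ∑ (λ x → χ x * (x + k))             ≡⟨ ∑-cong (λ x → distribˡ (χ x) x k) ⟩
      ∑ (λ x → χ x * x + χ x * k)         ≡⟨ ∑-distrib (λ x → χ x * x) (λ x → χ x * k) ⟩
      ∑ (λ x → χ x * x) + ∑ (λ x → χ x * k) ≡⟨ cong (∑ (λ x → χ x * x) +_) (trans (∑-cong (λ x → *-comm (χ x) k)) (∑-*ˡ k χ)) ⟩
      ∑ (λ x → χ x * x) + k * ∑ χ         ∎)))
      where
      χ : Carrier → Carrier
      χ x = 𝟙 (h x ≟ m * x)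
      χ-periodic : ∀ x → χ (x + k) ≡ χ x
      χ-periodic x = 𝟙-cong (h (x + k) ≟ m * (x + k)) (h x ≟ m * x) (mk⇔
        (λ hx+k≡m[x+k] → +-cancelʳ (m * k) (h x) (m * x) (begin
          h x + m * k        ≡⟨ cong (h x +_) (sym hk≡mk) ⟩
          h x + h k          ≡⟨ sym (h-additive x k) ⟩
          h (x + k)          ≡⟨ hx+k≡m[x+k] ⟩
          m * (x + k)        ≡⟨ distribˡ m x k ⟩
          m * x + m * k      ∎))
        (λ hx≡mx → begin
          h (x + k)          ≡⟨ h-additive x k ⟩
          h x + h k          ≡⟨ cong₂ _+_ hx≡mx hk≡mk ⟩
          m * x + m * k      ≡⟨ sym (distribˡ m x k) ⟩
          m * (x + k)        ∎))

    slope0≢m : ∀ {m} → m ≢ 0# → slope h 0# ≢ m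
    slope0≢m m≢0 slope0≡m = m≢0 (trans (sym slope0≡m) (trans (cong (_* 0# ^ pred L) h0≡0) (zeroˡ _)))

    slopeCount : Carrier → Carrier
    slopeCount m = ∑ (λ x → 𝟙 (slope h x ≟ m))

    kernel-split : ∀ {m} → m ≢ 0# → ∀ x → 𝟙 (h x ≟ m * x) ≡ 𝟙 (0# ≟ x) + 𝟙 (slope h x ≟ m)
    kernel-split {m} m≢0 x with 0# ≟ x
    ... | yes refl = begin
      𝟙 (h 0# ≟ m * 0#)                ≡⟨ 𝟙-yes (h 0# ≟ m * 0#) (trans h0≡0 (sym (zeroʳ m))) ⟩
      1#                               ≡⟨ sym (+-identityʳ 1#) ⟩
      1# + 0#                          ≡⟨ cong (1# +_) (sym (𝟙-no (slope h 0# ≟ m) (slope0≢m m≢0))) ⟩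
      1# + 𝟙 (slope h 0# ≟ m)          ∎
    ... | no 0≢x =
      trans (𝟙-cong (h x ≟ m * x) (slope h x ≟ m) (mk⇔ (Equivalence.from (slope≡⇔ x≢0)) (Equivalence.to (slope≡⇔ x≢0))))
            (sym (+-identityˡ _))
      where x≢0 = 0≢x ∘ sym

    slopeCount-yes : ∀ {m} → m ≢ 0# → HasSlope h m → slopeCount m ≡ - 1#
    slopeCount-yes {m} m≢0 hasSlope = +-inverseʳ-unique 1# (slopeCount m) (begin
      1# + slopeCount m                                   ≡⟨ cong (_+ slopeCount m) (sym (∑-δ 0# (λ _ → 1#))) ⟩
      ∑ (λ x → 𝟙 (0# ≟ x) * 1#) + slopeCount m
        ≡⟨ sym (∑-distrib (λ x → 𝟙 (0# ≟ x) * 1#) (λ x → 𝟙 (slope h x ≟ m))) ⟩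
      ∑ (λ x → 𝟙 (0# ≟ x) * 1# + 𝟙 (slope h x ≟ m))
        ≡⟨ ∑-cong (λ x → trans (cong (_+ 𝟙 (slope h x ≟ m)) (*-identityʳ _)) (sym (kernel-split m≢0 x))) ⟩
      ∑ (λ x → 𝟙 (h x ≟ m * x))                          ≡⟨ ∑-kernel≡0 hasSlope ⟩
      0#                                                  ∎)

    slopeCount-no : ∀ {m} → m ≢ 0# → ¬ HasSlope h m → slopeCount m ≡ 0#
    slopeCount-no {m} m≢0 noSlope = trans (∑-cong (λ x → 𝟙-no (slope h x ≟ m) (notSlope x))) ∑-zero
      where
      notSlope : ∀ x → slope h x ≢ m
      notSlope x slope≡m with x ≟ 0#
      ... | yes refl = slope0≢m m≢0 slope≡m
      ... | no x≢0 = noSlope (x , x≢0 , Equivalence.to (slope≡⇔ x≢0) slope≡m)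

  ∑-slopes-cong : ∀ {f g} → (∀ x y → f (x + y) ≡ f x + f y) → (∀ x y → g (x + y) ≡ g x + g y) →
    (∀ m → HasSlope f m ⇔ HasSlope g m) → ∀ ψ → ψ 0# ≡ 0# →
    ∑ (λ x → ψ (slope f x)) ≡ ∑ (λ x → ψ (slope g x))
  ∑-slopes-cong {f} {g} f-additive g-additive sameSlopes ψ ψ0≡0 = begin
    ∑ (λ x → ψ (slope f x))            ≡⟨ ∑-fibres ψ (slope f) ⟩
    ∑ (λ m → ψ m * Sf.slopeCount m)    ≡⟨ ∑-cong sameTerm ⟩
    ∑ (λ m → ψ m * Sg.slopeCount m)    ≡⟨ sym (∑-fibres ψ (slope g)) ⟩
    ∑ (λ x → ψ (slope g x))            ∎
    where
    module Sf = SlopeCount f-additive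
    module Sg = SlopeCount g-additive

    sameCount : ∀ {m} → m ≢ 0# → Sf.slopeCount m ≡ Sg.slopeCount m
    sameCount {m} m≢0 with hasSlope? f m
    ... | yes fSlope  = trans (Sf.slopeCount-yes m≢0 fSlope) (sym (Sg.slopeCount-yes m≢0 (Equivalence.to (sameSlopes m) fSlope)))
    ... | no  ¬fSlope = trans (Sf.slopeCount-no m≢0 ¬fSlope) (sym (Sg.slopeCount-no m≢0 (¬fSlope ∘ Equivalence.from (sameSlopes m))))

    sameTerm : ∀ m → ψ m * Sf.slopeCount m ≡ ψ m * Sg.slopeCount m
    sameTerm m with m ≟ 0#
    ... | yes refl = trans (ψ0* (Sf.slopeCount 0#)) (sym (ψ0* (Sg.slopeCount 0#)))
      where
      ψ0* : ∀ c → ψ 0# * c ≡ 0#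
      ψ0* c = trans (cong (_* c) ψ0≡0) (zeroˡ c)
    ... | no  m≢0  = cong (ψ m *_) (sameCount m≢0)

  powerSum-residue : ∀ {E} → NonzeroResidue L E → powerSum E ≡ 0#
  powerSum-residue (e , t , 0<e , e<L , refl) = trans (powerSum-periodic 0<e t) (powerSum-vanishes 0<e e<L)

  ∑-⟦⟧ : ∀ c n ms → ∑ ⟦ (c , n) ∷ ms ⟧ ≡ c * powerSum n + ∑ ⟦ ms ⟧
  ∑-⟦⟧ c n ms = trans (∑-distrib (λ x → c * x ^ n) ⟦ ms ⟧) (cong (_+ ∑ ⟦ ms ⟧) (∑-*ˡ c (_^ n)))

  ∑-⟦⟧-vanishes : ∀ ms → All (λ (_ , n) → powerSum n ≡ 0#) ms → ∑ ⟦ ms ⟧ ≡ 0#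
  ∑-⟦⟧-vanishes []             []         = ∑-zero
  ∑-⟦⟧-vanishes ((c , n) ∷ ms) (v ∷ vs)   = begin
    ∑ ⟦ (c , n) ∷ ms ⟧          ≡⟨ ∑-⟦⟧ c n ms ⟩
    c * powerSum n + ∑ ⟦ ms ⟧   ≡⟨ cong₂ (λ a b → c * a + b) v (∑-⟦⟧-vanishes ms vs) ⟩
    c * 0# + 0#                 ≡⟨ trans (+-identityʳ _) (zeroʳ c) ⟩
    0#                          ∎

  ∑-⟦++⟧ : ∀ ms ns → ∑ ⟦ ms ++ ns ⟧ ≡ ∑ ⟦ ms ⟧ + ∑ ⟦ ns ⟧
  ∑-⟦++⟧ ms ns = trans (∑-cong (⟦++⟧ ms ns)) (∑-distrib ⟦ ms ⟧ ⟦ ns ⟧)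

-- q = k + 2, α = q - 1, β = q⁴ - 1 and L = q⁶ - 1 = α G with G = 1 + q + ⋯ + q⁵. In the expansion
-- of (a₁x^α + a₄x^β)^(q⁴+q²+1), the monomial taking c₁, c₂, c₃ ∈ {α, β} from the factors raised to
-- q⁴, q² and 1 has exponent E c₁ c₂ c₃.
module Exponents (k : ℕ) where
  open +-*-Solver

  α q G β L : ℕ
  α = suc k
  q = suc α
  G = 1 +ℕ q +ℕ q ^ℕ 2 +ℕ q ^ℕ 3 +ℕ q ^ℕ 4 +ℕ q ^ℕ 5
  β = α ℕ.* (1 +ℕ q +ℕ q ^ℕ 2 +ℕ q ^ℕ 3)
  L = α ℕ.* G

  E : ℕ → ℕ → ℕ → ℕ
  E c₁ c₂ c₃ = c₁ ℕ.* q ^ℕ 4 +ℕ c₂ ℕ.* q ^ℕ 2 +ℕ c₃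

  module Syntax {n} (a : Polynomial n) where
    α̃ q̃ G̃ β̃ L̃ : Polynomial n
    α̃ = con 1 :+ a
    q̃ = con 1 :+ α̃
    G̃ = con 1 :+ q̃ :+ q̃ :^ 2 :+ q̃ :^ 3 :+ q̃ :^ 4 :+ q̃ :^ 5
    β̃ = α̃ :* (con 1 :+ q̃ :+ q̃ :^ 2 :+ q̃ :^ 3)
    L̃ = α̃ :* G̃
    Ẽ : Polynomial n → Polynomial n → Polynomial n → Polynomial n
    Ẽ c₁ c₂ c₃ = c₁ :* q̃ :^ 4 :+ c₂ :* q̃ :^ 2 :+ c₃

  q^6≡1+L : q ^ℕ 6 ≡ suc L
  q^6≡1+L = solve 1 (λ a → let open Syntax a in q̃ :^ 6 := con 1 :+ L̃) refl k

  q^4≡1+β : q ^ℕ 4 ≡ suc β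
  q^4≡1+β = solve 1 (λ a → let open Syntax a in q̃ :^ 4 := con 1 :+ β̃) refl k

  residue : ∀ {e} D r t → 0 < D → 0 < r → D +ℕ r ≡ G → e ≡ α ℕ.* D +ℕ L ℕ.* t → NonzeroResidue L e
  residue D r t 0<D 0<r D+r≡G e≡ =
    α ℕ.* D , t , ℕ.>-nonZero⁻¹ (α ℕ.* D) {{ℕ.m*n≢0 α D {{_}} {{ℕ.>-nonZero 0<D}}}} ,
    ℕ.*-monoʳ-< α (subst (D <_) D+r≡G (ℕ.m<m+n D 0<r)) , e≡

  residue₁₁₁ : NonzeroResidue L (E α α α)
  residue₁₁₁ = residue (1 +ℕ q ^ℕ 2 +ℕ q ^ℕ 4) (q +ℕ q ^ℕ 3 +ℕ q ^ℕ 5) 0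
    (s≤s z≤n) (s≤s z≤n)
    (solve 1 (λ a → let open Syntax a in
      (con 1 :+ q̃ :^ 2 :+ q̃ :^ 4) :+ (q̃ :+ q̃ :^ 3 :+ q̃ :^ 5) := G̃) refl k)
    (solve 1 (λ a → let open Syntax a in
      Ẽ α̃ α̃ α̃ := α̃ :* (con 1 :+ q̃ :^ 2 :+ q̃ :^ 4) :+ L̃ :* con 0) refl k)

  residue₁₁₄ : NonzeroResidue L (E α α β)
  residue₁₁₄ = residue (1 +ℕ q +ℕ 2 ℕ.* q ^ℕ 2 +ℕ q ^ℕ 3 +ℕ q ^ℕ 4) (q ^ℕ 2 ℕ.* α ℕ.* (1 +ℕ q +ℕ q ^ℕ 2)) 0
    (s≤s z≤n) (s≤s z≤n)
    (solve 1 (λ a → let open Syntax a in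
      (con 1 :+ q̃ :+ con 2 :* q̃ :^ 2 :+ q̃ :^ 3 :+ q̃ :^ 4) :+ q̃ :^ 2 :* α̃ :* (con 1 :+ q̃ :+ q̃ :^ 2) := G̃) refl k)
    (solve 1 (λ a → let open Syntax a in
      Ẽ α̃ α̃ β̃ := α̃ :* (con 1 :+ q̃ :+ con 2 :* q̃ :^ 2 :+ q̃ :^ 3 :+ q̃ :^ 4) :+ L̃ :* con 0) refl k)

  residue₁₄₁ : NonzeroResidue L (E α β α)
  residue₁₄₁ = residue (q ℕ.* α ℕ.* (1 +ℕ q +ℕ q ^ℕ 2)) (1 +ℕ 2 ℕ.* q +ℕ q ^ℕ 2 +ℕ q ^ℕ 3 +ℕ q ^ℕ 5) 1
    (s≤s z≤n) (s≤s z≤n)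
    (solve 1 (λ a → let open Syntax a in
      q̃ :* α̃ :* (con 1 :+ q̃ :+ q̃ :^ 2) :+ (con 1 :+ con 2 :* q̃ :+ q̃ :^ 2 :+ q̃ :^ 3 :+ q̃ :^ 5) := G̃) refl k)
    (solve 1 (λ a → let open Syntax a in
      Ẽ α̃ β̃ α̃ := α̃ :* (q̃ :* α̃ :* (con 1 :+ q̃ :+ q̃ :^ 2)) :+ L̃ :* con 1) refl k)

  residue₁₄₄ : NonzeroResidue L (E α β β)
  residue₁₄₄ = residue (q ^ℕ 2 +ℕ q ^ℕ 3 +ℕ q ^ℕ 4) (1 +ℕ q +ℕ q ^ℕ 5) 1
    (s≤s z≤n) (s≤s z≤n)
    (solve 1 (λ a → let open Syntax a in
      (q̃ :^ 2 :+ q̃ :^ 3 :+ q̃ :^ 4) :+ (con 1 :+ q̃ :+ q̃ :^ 5) := G̃) refl k)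
    (solve 1 (λ a → let open Syntax a in
      Ẽ α̃ β̃ β̃ := α̃ :* (q̃ :^ 2 :+ q̃ :^ 3 :+ q̃ :^ 4) :+ L̃ :* con 1) refl k)

  residue₄₁₁ : NonzeroResidue L (E β α α)
  residue₄₁₁ = residue (2 +ℕ q +ℕ q ^ℕ 2 +ℕ q ^ℕ 4 +ℕ q ^ℕ 5) (α ℕ.* (1 +ℕ q +ℕ q ^ℕ 2)) (α ℕ.* (1 +ℕ q))
    (s≤s z≤n) (s≤s z≤n)
    (solve 1 (λ a → let open Syntax a in
      (con 2 :+ q̃ :+ q̃ :^ 2 :+ q̃ :^ 4 :+ q̃ :^ 5) :+ α̃ :* (con 1 :+ q̃ :+ q̃ :^ 2) := G̃) refl k)
    (solve 1 (λ a → let open Syntax a in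
      Ẽ β̃ α̃ α̃ := α̃ :* (con 2 :+ q̃ :+ q̃ :^ 2 :+ q̃ :^ 4 :+ q̃ :^ 5) :+ L̃ :* (α̃ :* (con 1 :+ q̃))) refl k)

  residue₄₁₄ : NonzeroResidue L (E β α β)
  residue₄₁₄ = residue (1 +ℕ q +ℕ q ^ℕ 2) (q ^ℕ 3 +ℕ q ^ℕ 4 +ℕ q ^ℕ 5) (1 +ℕ α ℕ.* (1 +ℕ q))
    (s≤s z≤n) (s≤s z≤n)
    (solve 1 (λ a → let open Syntax a in
      (con 1 :+ q̃ :+ q̃ :^ 2) :+ (q̃ :^ 3 :+ q̃ :^ 4 :+ q̃ :^ 5) := G̃) refl k)
    (solve 1 (λ a → let open Syntax a in
      Ẽ β̃ α̃ β̃ := α̃ :* (con 1 :+ q̃ :+ q̃ :^ 2) :+ L̃ :* (con 1 :+ α̃ :* (con 1 :+ q̃))) refl k)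

  residue₄₄₁ : NonzeroResidue L (E β β α)
  residue₄₄₁ = residue (1 +ℕ q ^ℕ 4 +ℕ q ^ℕ 5) (q +ℕ q ^ℕ 2 +ℕ q ^ℕ 3) (1 +ℕ α ℕ.* (1 +ℕ q))
    (s≤s z≤n) (s≤s z≤n)
    (solve 1 (λ a → let open Syntax a in
      (con 1 :+ q̃ :^ 4 :+ q̃ :^ 5) :+ (q̃ :+ q̃ :^ 2 :+ q̃ :^ 3) := G̃) refl k)
    (solve 1 (λ a → let open Syntax a in
      Ẽ β̃ β̃ α̃ := α̃ :* (con 1 :+ q̃ :^ 4 :+ q̃ :^ 5) :+ L̃ :* (con 1 :+ α̃ :* (con 1 :+ q̃))) refl k)

  L∣E₄₄₄ : L ∣ E β β β
  L∣E₄₄₄ = divides (2 +ℕ α ℕ.* (1 +ℕ q))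
    (solve 1 (λ a → let open Syntax a in
      Ẽ β̃ β̃ β̃ := (con 2 :+ α̃ :* (con 1 :+ q̃)) :* L̃) refl k)

module QBinomial (F : Field) (k : ℕ) (enum : Field.Carrier F ↔ Fin (suc (Exponents.L k)))
                 (q-additive : FieldProperties.Additive F (Exponents.q k)) where
  open Exponents k
  open FieldProperties F
  open FiniteField F L enum
  open ≡-Reasoning

  qBinomial : Carrier → Carrier → Carrier → Carrier
  qBinomial a₁ a₄ x = a₁ * x ^ q + a₄ * x ^ (q ^ℕ 4)

  qBinomial-additive : ∀ a₁ a₄ x y → qBinomial a₁ a₄ (x + y) ≡ qBinomial a₁ a₄ x + qBinomial a₁ a₄ y
  qBinomial-additive a₁ a₄ x y = begin
    a₁ * (x + y) ^ q + a₄ * (x + y) ^ (q ^ℕ 4)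
      ≡⟨ cong₂ (λ u v → a₁ * u + a₄ * v) (q-additive x y) (Additive-^ {q} q-additive 4 x y) ⟩
    a₁ * (x ^ q + y ^ q) + a₄ * (x ^ (q ^ℕ 4) + y ^ (q ^ℕ 4))
      ≡⟨ solve 6 (λ a b u v w z → a :* (u :+ v) :+ b :* (w :+ z) := (a :* u :+ b :* w) :+ (a :* v :+ b :* z))
               refl a₁ a₄ (x ^ q) (y ^ q) (x ^ (q ^ℕ 4)) (y ^ (q ^ℕ 4)) ⟩
    (a₁ * x ^ q + a₄ * x ^ (q ^ℕ 4)) + (a₁ * y ^ q + a₄ * y ^ (q ^ℕ 4)) ∎

  slopeTerms : Carrier → Carrier → List Monomial
  slopeTerms a₁ a₄ = (a₁ , α) ∷ (a₄ , β) ∷ []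

  slope-qBinomial : ∀ a₁ a₄ x → slope (qBinomial a₁ a₄) x ≡ ⟦ slopeTerms a₁ a₄ ⟧ x
  slope-qBinomial a₁ a₄ x = begin
    (a₁ * x ^ q + a₄ * x ^ (q ^ℕ 4)) * x ^ pred L
      ≡⟨ distribʳ _ _ _ ⟩
    a₁ * x ^ q * x ^ pred L + a₄ * x ^ (q ^ℕ 4) * x ^ pred L
      ≡⟨ cong₂ _+_ (shift a₁ {α} (s≤s z≤n)) (trans (cong (λ n → a₄ * x ^ n * x ^ pred L) q^4≡1+β) (shift a₄ {β} (s≤s z≤n))) ⟩
    a₁ * x ^ α + a₄ * x ^ β
      ≡⟨ cong (a₁ * x ^ α +_) (sym (+-identityʳ _)) ⟩
    a₁ * x ^ α + (a₄ * x ^ β + 0#) ∎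
    where
    shift : ∀ c {a} → 0 < a → c * x ^ suc a * x ^ pred L ≡ c * x ^ a
    shift c 0<a = trans (*-assoc _ _ _) (cong (c *_) (^-shift x 0<a))

  -- the exponent of the norm from GF(q⁶) to GF(q²)
  ν : ℕ
  ν = q ^ℕ 4 +ℕ q ^ℕ 2 +ℕ 1

  expansion : Carrier → Carrier → List Monomial
  expansion a₁ a₄ = (ms ^ᴹ (q ^ℕ 4) ⊗ ms ^ᴹ (q ^ℕ 2)) ⊗ ms
    where ms = slopeTerms a₁ a₄

  ⟦expansion⟧ : ∀ a₁ a₄ x → ⟦ slopeTerms a₁ a₄ ⟧ x ^ ν ≡ ⟦ expansion a₁ a₄ ⟧ x
  ⟦expansion⟧ a₁ a₄ x = begin
    P ^ (q ^ℕ 4 +ℕ q ^ℕ 2 +ℕ 1)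
      ≡⟨ ^-homo-+ P (q ^ℕ 4 +ℕ q ^ℕ 2) 1 ⟩
    P ^ (q ^ℕ 4 +ℕ q ^ℕ 2) * P ^ 1
      ≡⟨ cong₂ _*_ (^-homo-+ P (q ^ℕ 4) (q ^ℕ 2)) (*-identityʳ P) ⟩
    (P ^ (q ^ℕ 4) * P ^ (q ^ℕ 2)) * P
      ≡⟨ cong (_* P) (sym (cong₂ _*_ (⟦^ᴹ⟧ {q ^ℕ 4} (Additive-^ {q} q-additive 4) ms x)
                                     (⟦^ᴹ⟧ {q ^ℕ 2} (Additive-^ {q} q-additive 2) ms x))) ⟩
    (⟦ ms ^ᴹ (q ^ℕ 4) ⟧ x * ⟦ ms ^ᴹ (q ^ℕ 2) ⟧ x) * P
      ≡⟨ cong (_* P) (sym (⟦⊗⟧ (ms ^ᴹ (q ^ℕ 4)) (ms ^ᴹ (q ^ℕ 2)) x)) ⟩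
    ⟦ ms ^ᴹ (q ^ℕ 4) ⊗ ms ^ᴹ (q ^ℕ 2) ⟧ x * P
      ≡⟨ sym (⟦⊗⟧ (ms ^ᴹ (q ^ℕ 4) ⊗ ms ^ᴹ (q ^ℕ 2)) ms x) ⟩
    ⟦ expansion a₁ a₄ ⟧ x ∎
    where
    ms = slopeTerms a₁ a₄
    P = ⟦ ms ⟧ x

  -- the expansion lists the choices of (a₁, α) or (a₄, β) from the three factors in the
  -- order 111, 114, 141, 144, 411, 414, 441, 444
  ∑-slope^ν : ∀ a₁ a₄ → ∑ (λ x → slope (qBinomial a₁ a₄) x ^ ν) ≡ - (a₄ ^ ν)
  ∑-slope^ν a₁ a₄ = begin
    ∑ (λ x → slope (qBinomial a₁ a₄) x ^ ν)
      ≡⟨ ∑-cong (λ x → trans (cong (_^ ν) (slope-qBinomial a₁ a₄ x)) (⟦expansion⟧ a₁ a₄ x)) ⟩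
    ∑ ⟦ e ⟧
      ≡⟨ cong (∑ ∘ ⟦_⟧) (sym (take++drop≡id 7 e)) ⟩
    ∑ ⟦ take 7 e ++ drop 7 e ⟧
      ≡⟨ ∑-⟦++⟧ (take 7 e) (drop 7 e) ⟩
    ∑ ⟦ take 7 e ⟧ + ∑ ⟦ drop 7 e ⟧
      ≡⟨ cong₂ _+_ (∑-⟦⟧-vanishes (take 7 e) vanishing) (∑-⟦⟧ c (E β β β) []) ⟩
    0# + (c * powerSum (E β β β) + ∑ (λ _ → 0#))
      ≡⟨ cong₂ (λ u v → 0# + (c * u + v)) (powerSum-multiple (s≤s z≤n) L∣E₄₄₄) ∑-zero ⟩
    0# + (c * - 1# + 0#)
      ≡⟨ trans (+-identityˡ _) (trans (+-identityʳ _) (sym (-‿distribʳ-* c 1#))) ⟩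
    - (c * 1#)
      ≡⟨ cong -_ (trans (*-identityʳ c) c≡a₄^ν) ⟩
    - (a₄ ^ ν) ∎
    where
    e = expansion a₁ a₄
    c = (a₄ ^ (q ^ℕ 4) * a₄ ^ (q ^ℕ 2)) * a₄
    vanishing : All (λ (_ , n) → powerSum n ≡ 0#) (take 7 e)
    vanishing = powerSum-residue residue₁₁₁ ∷ powerSum-residue residue₁₁₄ ∷ powerSum-residue residue₁₄₁ ∷
                powerSum-residue residue₁₄₄ ∷ powerSum-residue residue₄₁₁ ∷ powerSum-residue residue₄₁₄ ∷
                powerSum-residue residue₄₄₁ ∷ []
    c≡a₄^ν : c ≡ a₄ ^ ν
    c≡a₄^ν = sym (trans (^-homo-+ a₄ (q ^ℕ 4 +ℕ q ^ℕ 2) 1) (cong₂ _*_ (^-homo-+ a₄ (q ^ℕ 4) (q ^ℕ 2)) (*-identityʳ a₄)))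

  sameL⇒sameNorm : ∀ a₁ a₄ b₁ b₄ → SameL (qBinomial a₁ a₄) (qBinomial b₁ b₄) → a₄ ^ ν ≡ b₄ ^ ν
  sameL⇒sameNorm a₁ a₄ b₁ b₄ Lf≡Lg = -‿injective (begin
    - (a₄ ^ ν)                                 ≡⟨ sym (∑-slope^ν a₁ a₄) ⟩
    ∑ (λ x → slope (qBinomial a₁ a₄) x ^ ν)    ≡⟨ ∑-slopes-cong (qBinomial-additive a₁ a₄) (qBinomial-additive b₁ b₄)
                                                                (SameL⇒sameSlopes Lf≡Lg) (_^ ν) 0^ν≡0 ⟩
    ∑ (λ x → slope (qBinomial b₁ b₄) x ^ ν)    ≡⟨ ∑-slope^ν b₁ b₄ ⟩
    - (b₄ ^ ν)                                 ∎)
    where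
    0^ν≡0 : 0# ^ ν ≡ 0#
    0^ν≡0 = trans (cong (0# ^_) (ℕ.+-comm (q ^ℕ 4 +ℕ q ^ℕ 2) 1)) (0^[1+n]≡0 (q ^ℕ 4 +ℕ q ^ℕ 2))

lemma4p2 : (p k : ℕ) → Prime p → (q : ℕ) → q ≡ p ^ℕ suc k →
    (F : Field) → Field.HasOrder F (q ^ℕ 6) →
    let open Field F in
    (a₁ a₄ b₁ b₄ : Carrier) →
    SameL (λ x → a₁ * x ^ q + a₄ * x ^ (q ^ℕ 4))
          (λ x → b₁ * x ^ q + b₄ * x ^ (q ^ℕ 4)) →
    a₄ ^ (q ^ℕ 4 +ℕ q ^ℕ 2 +ℕ 1) ≡ b₄ ^ (q ^ℕ 4 +ℕ q ^ℕ 2 +ℕ 1)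
lemma4p2 p k p-prime q q≡pᵏ⁺¹ F order with ≥2⇒2+ (subst (2 ≤_) (sym q≡pᵏ⁺¹) (prime^[1+k]≥2 p-prime k))
... | k′ , refl = QBinomial.sameL⇒sameNorm F k′ enum q-additive
  where
  open Exponents k′ using (L; q^6≡1+L)
  open FieldProperties F
  enum : Carrier ↔ Fin (suc L)
  enum = subst (λ n → Carrier ↔ Fin n) q^6≡1+L order
  open FiniteField F L enum
  open ≡-Reasoning
  p·1≡0 : p · 1# ≡ 0#
  p·1≡0 = ^≡order⇒·1≡0 {p} (suc k ℕ.* 6) (begin
    p ^ℕ (suc k ℕ.* 6)  ≡⟨ sym (ℕ.^-*-assoc p (suc k) 6) ⟩
    (p ^ℕ suc k) ^ℕ 6   ≡⟨ cong (_^ℕ 6) (sym q≡pᵏ⁺¹) ⟩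
    q ^ℕ 6              ≡⟨ q^6≡1+L ⟩
    suc L               ∎)
  q-additive : Additive q
  q-additive = subst Additive (sym q≡pᵏ⁺¹) (Additive-^ {p} (frobenius p-prime p·1≡0) (suc k))
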